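{- Let $n, e$ be positive integers. Then $\mathcal C_e(\mathsf T_n) \subseteq \mathcal C_e(\mathsf T_{n+2^{e}})$.
   Context: For $a\in\mathbb Z$, $\overline{a}^{(e)}$ denotes the residue class of $a$ modulo $2^e$. $\mathsf T_n$ is the set of $n\times n$ matrices $M$ with entries in $\{1,-1\}$, all diagonal entries equal to $1$, and $(M-I)^\top=-(M-I)$. For a set $\mathsf M_n$ of $n\times n$ integer matrices, $\mathcal C_e(\mathsf M_n)$ is the set of tuples $\left(\overline{a_2}^{(e)},\dots,\overline{a_e}^{(e)}\right)$ such that $\det(xI-M)=\sum_{i=0}^n a_i x^{n-i}$ for some $M\in\mathsf M_n$ (with $a_i:=0$ for $i>n$). -}

module Defs where

open import Data.Nat as ℕ using (ℕ; zero; suc; _≤?_)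
open import Data.Integer as ℤ using (ℤ; +_; -_; -1ℤ; 0ℤ; 1ℤ)
open import Data.Integer.Divisibility using (_∣_)
open import Data.Fin as Fin using (Fin; zero; suc; punchIn; toℕ)
open import Data.List using (List; []; _∷_)
open import Relation.Binary.PropositionalEquality using (_≡_; _≢_)
open import Data.Product using (Σ; _×_)
open import Relation.Nullary using (yes; no)

-- Univariate integer polynomials as coefficient lists (lowest degree first)

Poly : Set
Poly = List ℤ

infixl 6 _+ₚ_
infixl 7 _*ₚ_ _·ₚ_

_+ₚ_ : Poly → Poly → Poly
[]       +ₚ q        = q
(a ∷ p)  +ₚ []       = a ∷ p
(a ∷ p)  +ₚ (b ∷ q)  = (a ℤ.+ b) ∷ (p +ₚ q)

_·ₚ_ : ℤ → Poly → Poly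
c ·ₚ []      = []
c ·ₚ (a ∷ p) = (c ℤ.* a) ∷ (c ·ₚ p)

_*ₚ_ : Poly → Poly → Poly
[]      *ₚ q = []
(a ∷ p) *ₚ q = (a ·ₚ q) +ₚ (0ℤ ∷ (p *ₚ q))

constₚ : ℤ → Poly
constₚ c = c ∷ []

Xₚ : Poly
Xₚ = 0ℤ ∷ 1ℤ ∷ []

coeff : Poly → ℕ → ℤ
coeff []      k       = 0ℤ
coeff (a ∷ p) zero    = a
coeff (a ∷ p) (suc k) = coeff p k

Matrix : Set → ℕ → Set
Matrix A n = Fin n → Fin n → A

minor : ∀ {A : Set} {n} → Matrix A (suc n) → Fin (suc n) → Matrix A n
minor M j r c = M (suc r) (punchIn j c)

sign : ℕ → ℤ
sign zero          = 1ℤ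
sign (suc zero)    = -1ℤ
sign (suc (suc k)) = sign k

sumFin : ∀ {n} → (Fin n → Poly) → Poly
sumFin {zero}  f = []
sumFin {suc n} f = f zero +ₚ sumFin (λ j → f (suc j))

detₚ : ∀ n → Matrix Poly n → Poly
detₚ zero    M = constₚ 1ℤ
detₚ (suc n) M = sumFin (λ j → (sign (toℕ j) ·ₚ (M zero j *ₚ detₚ n (minor M j))))

charPoly : ∀ n → Matrix ℤ n → Poly
charPoly n M = detₚ n entry
  where
  entry : Fin n → Fin n → Poly
  entry i j with i Fin.≟ j
  ... | yes _ = Xₚ +ₚ constₚ (- M i j)
  ... | no  _ = constₚ (- M i j)

-- a_i where det(xI - M) = Σ_{i=0}^n a_i x^{n-i}, and a_i = 0 for i > n
charCoeff : ∀ n → Matrix ℤ n → ℕ → ℤ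
charCoeff n M i with i ℕ.≤? n
... | yes _ = coeff (charPoly n M) (n ℕ.∸ i)
... | no  _ = 0ℤ

data IsSign : ℤ → Set where
  plus  : IsSign 1ℤ
  minus : IsSign -1ℤ

record InT (n : ℕ) (M : Matrix ℤ n) : Set where
  field
    entries : ∀ i j → IsSign (M i j)
    diag1   : ∀ i → M i i ≡ 1ℤ
    skew    : ∀ i j → i ≢ j → M j i ≡ - M i j

_≡[mod2^_]_ : ℤ → ℕ → ℤ → Set
a ≡[mod2^ e ] b = (+ (2 ℕ.^ e)) ∣ (a ℤ.- b)

-- membership of a residue tuple in C_e(T_n):
-- (a_2 mod 2^e, ..., a_e mod 2^e) comes from some M ∈ T_n
InC : (e n : ℕ) → (ℕ → ℤ) → Set
InC e n a = Σ (Matrix ℤ n) λ M → InT n M ×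
              (∀ i → 2 ℕ.≤ i → i ℕ.≤ e → charCoeff n M i ≡[mod2^ e ] a i)

{-# OPTIONS --safe #-}

-- Write χ(A) = det (xI - A) and let J be the all-ones matrix. Take M′ = M ⊳ T, where T is the
-- transitive tournament on m = 2^e vertices and every vertex of M beats every vertex of T.
-- Since det (A + cJ) is affine in c, χ(M′ - J) + χ(M′ + J) = 2 χ(M′). Now M′ - J is block lower
-- and M′ + J block upper triangular, with diagonal blocks M ∓ J and T ∓ J, and T - J is strictly
-- lower triangular while T + J is upper triangular with diagonal 2; hence
--   2 χ(M′) = χ(M - J) x^m + χ(M + J) (x - 2)^m.
-- As (x - 2)^(2^e) ≡ x^(2^e) modulo 2^(e+1), the right hand side is 2 x^m χ(M) modulo 2^(e+1),
-- so χ(M′) ≡ x^m χ(M) modulo 2^e, which says that M′ and M have the same a_i modulo 2^e.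

module Submission where

open import Defs
open import Algebra.Bundles using (CommutativeRing)
open import Data.Empty using (⊥-elim)
open import Data.Fin as Fin using (Fin; zero; suc; toℕ; punchIn; inject₁; splitAt; _↑ˡ_; _↑ʳ_)
import Data.Fin.Properties as Fin
open import Data.Nat as ℕ using (ℕ; zero; suc; s≤s; z≤n; _^_)
import Data.Nat.Properties as ℕ
open import Data.Product using (Σ; ∃; _,_; proj₁; proj₂)
open import Level using (0ℓ)
import Relation.Binary.PropositionalEquality as ≡
open ≡ using (_≡_; _≢_)

toℕ-punchIn-< : ∀ {m} (i : Fin (suc m)) (c : Fin m) → toℕ c ℕ.< toℕ i → toℕ (punchIn i c) ≡ toℕ c
toℕ-punchIn-< (suc i) zero    _   = ≡.refl
toℕ-punchIn-< (suc i) (suc c) c<i = ≡.cong suc (toℕ-punchIn-< i c (ℕ.s<s⁻¹ c<i))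

toℕ-punchIn-≥ : ∀ {m} (i : Fin (suc m)) (c : Fin m) → toℕ i ℕ.≤ toℕ c → toℕ (punchIn i c) ≡ suc (toℕ c)
toℕ-punchIn-≥ zero    c       _   = ≡.refl
toℕ-punchIn-≥ (suc i) (suc c) i≤c = ≡.cong suc (toℕ-punchIn-≥ i c (ℕ.s≤s⁻¹ i≤c))

toℕ-punchIn-≤ : ∀ {m} (i : Fin (suc m)) (c : Fin m) → toℕ (punchIn i c) ℕ.≤ suc (toℕ c)
toℕ-punchIn-≤ zero    c       = ℕ.≤-refl
toℕ-punchIn-≤ (suc i) zero    = z≤n
toℕ-punchIn-≤ (suc i) (suc c) = s≤s (toℕ-punchIn-≤ i c)

punchIn-↑ˡ : ∀ {a} b (i : Fin (suc a)) (c : Fin a) → punchIn (i ↑ˡ b) (c ↑ˡ b) ≡ punchIn i c ↑ˡ b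
punchIn-↑ˡ b zero    c       = ≡.refl
punchIn-↑ˡ b (suc i) zero    = ≡.refl
punchIn-↑ˡ b (suc i) (suc c) = ≡.cong suc (punchIn-↑ˡ b i c)

punchIn-↑ʳ : ∀ a {b} (i : Fin (suc a)) (c : Fin b) → punchIn (i ↑ˡ b) (a ↑ʳ c) ≡ suc a ↑ʳ c
punchIn-↑ʳ zero    zero    c = ≡.refl
punchIn-↑ʳ (suc a) zero    c = ≡.refl
punchIn-↑ʳ (suc a) (suc i) c = ≡.cong suc (punchIn-↑ʳ a i c)

punchIn-swap : ∀ {m} (j : Fin (suc (suc m))) (k : Fin (suc m)) j′ k′ →
               punchIn j k ≡ j′ → punchIn j′ k′ ≡ j →
               ∀ c → punchIn j (punchIn k c) ≡ punchIn j′ (punchIn k′ c)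
punchIn-swap zero    k       _ zero     ≡.refl _  c = ≡.refl
punchIn-swap (suc j) zero    _ k′       ≡.refl e′ c rewrite Fin.suc-injective e′ = ≡.refl
punchIn-swap {suc m} (suc j) (suc k) _ (suc k′) ≡.refl e′ zero    = ≡.refl
punchIn-swap {suc m} (suc j) (suc k) _ (suc k′) ≡.refl e′ (suc c) =
  ≡.cong suc (punchIn-swap j k _ k′ ≡.refl (Fin.suc-injective e′) c)

toℕ-↑ʳ-≥ : ∀ a {b} (j : Fin b) → a ℕ.≤ toℕ (a ↑ʳ j)
toℕ-↑ʳ-≥ a j = ℕ.≤-trans (ℕ.m≤m+n a (toℕ j)) (ℕ.≤-reflexive (≡.sym (Fin.toℕ-↑ʳ a j)))

topLeft : ∀ {A : Set} a b → Matrix A (a ℕ.+ b) → Matrix A a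
topLeft a b X i j = X (i ↑ˡ b) (j ↑ˡ b)

bottomRight : ∀ {A : Set} a b → Matrix A (a ℕ.+ b) → Matrix A b
bottomRight a b X i j = X (a ↑ʳ i) (a ↑ʳ j)

-- Determinants over a commutative ring

module Determinant {ℓ} (R : CommutativeRing 0ℓ ℓ) where

  open CommutativeRing R hiding (zero)
  open import Algebra.Properties.Ring ring using (-1*x≈-x; -‿distribˡ-*; -‿distribʳ-*; -‿involutive; -‿+-comm)
  open import Algebra.Properties.CommutativeSemigroup +-commutativeSemigroup using (interchange)
  open import Algebra.Properties.CommutativeSemigroup *-commutativeSemigroup using (x∙yz≈y∙xz)
  open import Algebra.Properties.Semiring.Sum semiring
    using (sum; sum-cong-≋; sum-replicate-zero; ∑-distrib-+; *-distribˡ-sum; *-distribʳ-sum)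
  open import Algebra.Solver.Ring.NaturalCoefficients.Default commutativeSemiring
    using (solve; _:=_; _:+_; _:*_)
  open import Data.Vec.Functional using (Vector; _∷_; tail)
  open import Data.Vec.Functional.Relation.Binary.Equality.Setoid setoid using (_≋_)
  open import Relation.Binary.Reasoning.Setoid setoid

  sgn : ℕ → Carrier
  sgn zero    = 1#
  sgn (suc k) = - sgn k

  det : ∀ n → Matrix Carrier n → Carrier
  det zero    M = 1#
  det (suc n) M = sum λ j → sgn (toℕ j) * (M zero j * det n (minor M j))

  sum-zero : ∀ {n} {f : Vector Carrier n} → (∀ j → f j ≈ 0#) → sum f ≈ 0#
  sum-zero {n} f≈0 = trans (sum-cong-≋ f≈0) (sum-replicate-zero n)

  sum-neg : ∀ {n} (f : Vector Carrier n) → sum (λ j → - f j) ≈ - sum f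
  sum-neg f = begin
    sum (λ j → - f j)          ≈⟨ sum-cong-≋ (λ j → sym (-1*x≈-x (f j))) ⟩
    sum (λ j → - 1# * f j)     ≈⟨ *-distribˡ-sum (- 1#) f ⟨
    - 1# * sum f               ≈⟨ -1*x≈-x (sum f) ⟩
    - sum f                    ∎

  sum-linear : ∀ {n} {f g h : Vector Carrier n} α β →
               (∀ j → f j ≈ α * g j + β * h j) → sum f ≈ α * sum g + β * sum h
  sum-linear {f = f} {g} {h} α β f≈ = begin
    sum f                                        ≈⟨ sum-cong-≋ f≈ ⟩
    sum (λ j → α * g j + β * h j)                ≈⟨ ∑-distrib-+ (λ j → α * g j) (λ j → β * h j) ⟩
    sum (λ j → α * g j) + sum (λ j → β * h j)    ≈⟨ +-cong (*-distribˡ-sum α g) (*-distribˡ-sum β h) ⟨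
    α * sum g + β * sum h                        ∎

  sum-↑ : ∀ a {b} (f : Vector Carrier (a ℕ.+ b)) →
          sum f ≈ sum (λ i → f (i ↑ˡ b)) + sum (λ i → f (a ↑ʳ i))
  sum-↑ zero    f = sym (+-identityˡ _)
  sum-↑ (suc a) f = trans (+-congˡ (sum-↑ a (tail f))) (sym (+-assoc _ _ _))

  det-expand-cong : ∀ n {M N : Matrix Carrier (suc n)} → M zero ≋ N zero →
                    (∀ j → det n (minor M j) ≈ det n (minor N j)) → det (suc n) M ≈ det (suc n) N
  det-expand-cong n row₀ minors = sum-cong-≋ λ j → *-congˡ {sgn (toℕ j)} (*-cong (row₀ j) (minors j))

  det-cong : ∀ n {M N : Matrix Carrier n} → (∀ i → M i ≋ N i) → det n M ≈ det n N
  det-cong zero    M≋N = refl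
  det-cong (suc n) {M} {N} M≋N = det-expand-cong n {M} {N} (M≋N zero) λ j →
    det-cong n {minor M j} {minor N j} λ r c → M≋N (suc r) (punchIn j c)

  laplaceTerm-zeroˡ : ∀ s {x} d → x ≈ 0# → s * (x * d) ≈ 0#
  laplaceTerm-zeroˡ s d x≈0 = trans (*-congˡ (trans (*-congʳ x≈0) (zeroˡ d))) (zeroʳ s)

  laplaceTerm-zeroʳ : ∀ s x {d} → d ≈ 0# → s * (x * d) ≈ 0#
  laplaceTerm-zeroʳ s x d≈0 = trans (*-congˡ (trans (*-congˡ d≈0) (zeroʳ x))) (zeroʳ s)

  det-linear : ∀ {n} (r : Fin n) {A B C : Matrix Carrier n} α β →
               (∀ i → i ≢ r → C i ≋ A i) → (∀ i → i ≢ r → C i ≋ B i) →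
               C r ≋ (λ j → α * A r j + β * B r j) → det n C ≈ α * det n A + β * det n B
  det-linear {suc n} zero {A} {B} {C} α β C≋A C≋B C₀ = sum-linear α β λ j → begin
    sgn (toℕ j) * (C zero j * det n (minor C j))
      ≈⟨ *-congˡ (*-cong (C₀ j) refl) ⟩
    sgn (toℕ j) * ((α * A zero j + β * B zero j) * det n (minor C j))
      ≈⟨ distribute (sgn (toℕ j)) (A zero j) (B zero j) (det n (minor C j)) α β ⟩
    α * (sgn (toℕ j) * (A zero j * det n (minor C j))) + β * (sgn (toℕ j) * (B zero j * det n (minor C j)))
      ≈⟨ +-cong (*-congˡ (*-congˡ (*-congˡ (minors C≋A j)))) (*-congˡ (*-congˡ (*-congˡ (minors C≋B j)))) ⟩
    α * (sgn (toℕ j) * (A zero j * det n (minor A j))) + β * (sgn (toℕ j) * (B zero j * det n (minor B j)))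
      ∎
    where
    distribute : ∀ s a b d α β → s * ((α * a + β * b) * d) ≈ α * (s * (a * d)) + β * (s * (b * d))
    distribute = solve 6 (λ s a b d α β →
      s :* ((α :* a :+ β :* b) :* d) := α :* (s :* (a :* d)) :+ β :* (s :* (b :* d))) refl
    minors : ∀ {D} → (∀ i → i ≢ zero → C i ≋ D i) → ∀ j → det n (minor C j) ≈ det n (minor D j)
    minors {D} C≋D j = det-cong n {minor C j} {minor D j} λ r c → C≋D (suc r) (λ ()) (punchIn j c)
  det-linear {suc n} (suc r) {A} {B} {C} α β C≋A C≋B Cᵣ = sum-linear α β λ j → begin
    sgn (toℕ j) * (C zero j * det n (minor C j))
      ≈⟨ *-congˡ (*-congˡ (det-linear r α β (minorRows C≋A j) (minorRows C≋B j) (λ c → Cᵣ (punchIn j c)))) ⟩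
    sgn (toℕ j) * (C zero j * (α * det n (minor A j) + β * det n (minor B j)))
      ≈⟨ distribute (sgn (toℕ j)) (C zero j) (det n (minor A j)) (det n (minor B j)) α β ⟩
    α * (sgn (toℕ j) * (C zero j * det n (minor A j))) + β * (sgn (toℕ j) * (C zero j * det n (minor B j)))
      ≈⟨ +-cong (*-congˡ (*-congˡ (*-congʳ (C≋A zero (λ ()) j)))) (*-congˡ (*-congˡ (*-congʳ (C≋B zero (λ ()) j)))) ⟩
    α * (sgn (toℕ j) * (A zero j * det n (minor A j))) + β * (sgn (toℕ j) * (B zero j * det n (minor B j)))
      ∎
    where
    distribute : ∀ s c x y α β → s * (c * (α * x + β * y)) ≈ α * (s * (c * x)) + β * (s * (c * y))
    distribute = solve 6 (λ s c x y α β →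
      s :* (c :* (α :* x :+ β :* y)) := α :* (s :* (c :* x)) :+ β :* (s :* (c :* y))) refl
    minorRows : ∀ {D} → (∀ i → i ≢ suc r → C i ≋ D i) →
                ∀ j i → i ≢ r → minor C j i ≋ minor D j i
    minorRows C≋D j i i≢r c = C≋D (suc i) (λ eq → i≢r (Fin.suc-injective eq)) (punchIn j c)

  -x*-y≈x*y : ∀ x y → - x * - y ≈ x * y
  -x*-y≈x*y x y = begin
    - x * - y      ≈⟨ -‿distribˡ-* x (- y) ⟨
    - (x * - y)    ≈⟨ -‿cong (-‿distribʳ-* x y) ⟨
    - - (x * y)    ≈⟨ -‿involutive (x * y) ⟩
    x * y          ∎

  -- The pairs (j , punchIn j k) enumerate the ordered pairs of distinct indices; the
  -- hypothesis says H is invariant under exchanging the two members, which flips the sign.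
  ∑-swap-cancel : ∀ m (H : Fin (suc m) → Fin m → Carrier) →
                  (∀ j k j′ k′ → punchIn j k ≡ j′ → punchIn j′ k′ ≡ j → H j k ≈ H j′ k′) →
                  sum (λ j → sgn (toℕ j) * sum (λ k → sgn (toℕ k) * H j k)) ≈ 0#
  ∑-swap-cancel zero    H H-swap = trans (+-identityʳ _) (zeroʳ _)
  ∑-swap-cancel (suc m) H H-swap = begin
    1# * X + sum (λ j → - sgn (toℕ j) * (1# * H (suc j) zero + sum (λ k → - sgn (toℕ k) * H (suc j) (suc k))))
      ≈⟨ +-cong (*-identityˡ X) (sum-cong-≋ row) ⟩
    X + sum (λ j → - (sgn (toℕ j) * H zero j) + sgn (toℕ j) * Y j)
      ≈⟨ +-congˡ (∑-distrib-+ (λ j → - (sgn (toℕ j) * H zero j)) (λ j → sgn (toℕ j) * Y j)) ⟩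
    X + (sum (λ j → - (sgn (toℕ j) * H zero j)) + sum (λ j → sgn (toℕ j) * Y j))
      ≈⟨ +-congˡ (+-cong (sum-neg (λ j → sgn (toℕ j) * H zero j)) (∑-swap-cancel m (λ j k → H (suc j) (suc k)) H-swap′)) ⟩
    X + (- X + 0#)
      ≈⟨ trans (+-congˡ (+-identityʳ (- X))) (-‿inverseʳ X) ⟩
    0# ∎
    where
    X : Carrier
    X = sum (λ k → sgn (toℕ k) * H zero k)
    Y : Fin (suc m) → Carrier
    Y j = sum (λ k → sgn (toℕ k) * H (suc j) (suc k))
    row : ∀ j → - sgn (toℕ j) * (1# * H (suc j) zero + sum (λ k → - sgn (toℕ k) * H (suc j) (suc k)))
                ≈ - (sgn (toℕ j) * H zero j) + sgn (toℕ j) * Y j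
    row j = begin
      - s * (1# * H (suc j) zero + sum (λ k → - sgn (toℕ k) * H (suc j) (suc k)))
        ≈⟨ *-congˡ (+-cong (trans (*-identityˡ _) (H-swap (suc j) zero zero j ≡.refl ≡.refl))
                           (trans (sum-cong-≋ λ k → sym (-‿distribˡ-* (sgn (toℕ k)) (H (suc j) (suc k))))
                                  (sum-neg λ k → sgn (toℕ k) * H (suc j) (suc k)))) ⟩
      - s * (H zero j + - Y j)    ≈⟨ distribˡ (- s) _ _ ⟩
      - s * H zero j + - s * - Y j
        ≈⟨ +-cong (sym (-‿distribˡ-* s (H zero j))) (-x*-y≈x*y s (Y j)) ⟩
      - (s * H zero j) + s * Y j  ∎
      where
      s : Carrier
      s = sgn (toℕ j)
    H-swap′ : ∀ j k j′ k′ → punchIn j k ≡ j′ → punchIn j′ k′ ≡ j → H (suc j) (suc k) ≈ H (suc j′) (suc k′)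
    H-swap′ j k j′ k′ e e′ = H-swap (suc j) (suc k) (suc j′) (suc k′) (≡.cong suc e) (≡.cong suc e′)

  det-rows01 : ∀ {m} (M : Matrix Carrier (suc (suc m))) → M zero ≋ M (suc zero) → det (suc (suc m)) M ≈ 0#
  det-rows01 {m} M row₀≋row₁ = trans (sum-cong-≋ expand) (∑-swap-cancel (suc m) H H-swap)
    where
    D : Fin (suc (suc m)) → Fin (suc m) → Carrier
    D j k = det m (minor (minor M j) k)
    H : Fin (suc (suc m)) → Fin (suc m) → Carrier
    H j k = M zero j * (M (suc zero) (punchIn j k) * D j k)
    expand : ∀ j → sgn (toℕ j) * (M zero j * det (suc m) (minor M j))
                   ≈ sgn (toℕ j) * sum (λ k → sgn (toℕ k) * H j k)
    expand j = *-congˡ (trans (*-distribˡ-sum (M zero j) (λ k → sgn (toℕ k) * (M (suc zero) (punchIn j k) * D j k)))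
                              (sum-cong-≋ λ k → x∙yz≈y∙xz (M zero j) (sgn (toℕ k)) (M (suc zero) (punchIn j k) * D j k)))
    H-swap : ∀ j k j′ k′ → punchIn j k ≡ j′ → punchIn j′ k′ ≡ j → H j k ≈ H j′ k′
    H-swap j k j′ k′ e e′ = begin
      M zero j * (M (suc zero) (punchIn j k) * D j k)
        ≈⟨ *-cong (row₀≋row₁ j) (*-cong (reflexive (≡.cong (M (suc zero)) e)) (det-cong m λ r c →
             reflexive (≡.cong (M (suc (suc r))) (punchIn-swap j k j′ k′ e e′ c)))) ⟩
      M (suc zero) j * (M (suc zero) j′ * D j′ k′)   ≈⟨ x∙yz≈y∙xz _ _ _ ⟩
      M (suc zero) j′ * (M (suc zero) j * D j′ k′)
        ≈⟨ *-cong (sym (row₀≋row₁ j′)) (*-congʳ (reflexive (≡.cong (M (suc zero)) (≡.sym e′)))) ⟩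
      M zero j′ * (M (suc zero) (punchIn j′ k′) * D j′ k′) ∎

  det-row₁+row₀ : ∀ {n} (A C : Matrix Carrier (suc (suc n))) λ′ →
                  C zero ≋ A zero → (∀ i → C (suc (suc i)) ≋ A (suc (suc i))) →
                  C (suc zero) ≋ (λ j → A (suc zero) j + λ′ * A zero j) →
                  det (suc (suc n)) C ≈ det (suc (suc n)) A
  det-row₁+row₀ {n} A C λ′ C₀ C₂₊ C₁ = begin
    det _ C                    ≈⟨ det-linear (suc zero) {A} {B} {C} 1# λ′ C≋A C≋B
                                    (λ j → trans (C₁ j) (+-congʳ (sym (*-identityˡ _)))) ⟩
    1# * det _ A + λ′ * det _ B  ≈⟨ +-cong (*-identityˡ _) (trans (*-congˡ (det-rows01 B λ _ → refl)) (zeroʳ λ′)) ⟩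
    det _ A + 0#               ≈⟨ +-identityʳ _ ⟩
    det _ A                    ∎
    where
    B : Matrix Carrier (suc (suc n))
    B = A zero ∷ A zero ∷ tail (tail A)
    C≋A : ∀ i → i ≢ suc zero → C i ≋ A i
    C≋A zero          _ = C₀
    C≋A (suc zero)    1≢1 = ⊥-elim (1≢1 ≡.refl)
    C≋A (suc (suc i)) _ = C₂₊ i
    C≋B : ∀ i → i ≢ suc zero → C i ≋ B i
    C≋B zero          _ = C₀
    C≋B (suc zero)    1≢1 = ⊥-elim (1≢1 ≡.refl)
    C≋B (suc (suc i)) _ = C₂₊ i

  differences : ∀ {m n} → Vector (Vector Carrier m) (suc n) → Vector (Vector Carrier m) (suc n)
  differences rows zero    j = rows zero j
  differences rows (suc i) j = rows (suc i) j - rows (inject₁ i) j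

  -- Subtracting each row from the next one is a composite of row operations, performed
  -- from the bottom up; the last one, on rows 0 and 1, is the only one not inside a minor.
  det-differences : ∀ n (A : Matrix Carrier (suc n)) → det (suc n) (differences A) ≈ det (suc n) A
  det-differences zero    A = refl
  det-differences (suc n) A = begin
    det _ (differences A)  ≈⟨ det-row₁+row₀ B (differences A) (- 1#) (λ _ → refl) (λ _ _ → refl)
                                (λ j → +-congˡ (sym (-1*x≈-x _))) ⟩
    det _ B                ≈⟨ det-expand-cong (suc n) {B} {A} (λ _ → refl) (λ j →
                                trans (det-cong (suc n) {minor B j} {differences (minor A j)}
                                                λ { zero _ → refl ; (suc _) _ → refl })
                                      (det-differences n (minor A j))) ⟩
    det _ A                ∎
    where
    B : Matrix Carrier (suc (suc n))
    B = A zero ∷ differences (tail A)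

  det-+-affine : ∀ n (A : Matrix Carrier n) → ∃ λ κ → ∀ c → det n (λ i j → A i j + c) ≈ det n A + c * κ
  det-+-affine zero    A = 0# , λ c → sym (trans (+-congˡ (zeroʳ c)) (+-identityʳ 1#))
  det-+-affine (suc n) A = det (suc n) (ones ∷ tail (differences A)) , λ c → begin
    det _ (λ i j → A i j + c)                   ≈⟨ det-differences n (λ i j → A i j + c) ⟨
    det _ (differences (λ i j → A i j + c))
      ≈⟨ det-linear zero {differences A} {ones ∷ tail (differences A)} {differences (λ i j → A i j + c)} 1# c
           (λ { zero 0≢0 → ⊥-elim (0≢0 ≡.refl) ; (suc i) _ → rows c i })
           (λ { zero 0≢0 → ⊥-elim (0≢0 ≡.refl) ; (suc i) _ → rows c i })
           (λ j → +-cong (sym (*-identityˡ _)) (sym (*-identityʳ c))) ⟩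
    1# * det _ (differences A) + c * det _ (ones ∷ tail (differences A))
                                                ≈⟨ +-congʳ (trans (*-identityˡ _) (det-differences n A)) ⟩
    det _ A + c * det _ (ones ∷ tail (differences A)) ∎
    where
    ones : Vector Carrier (suc n)
    ones _ = 1#
    rows : ∀ c i → differences (λ i j → A i j + c) (suc i) ≋ differences A (suc i)
    rows c i j = begin
      (A (suc i) j + c) + - (A (inject₁ i) j + c)     ≈⟨ +-congˡ (sym (-‿+-comm _ _)) ⟩
      (A (suc i) j + c) + (- A (inject₁ i) j + - c)   ≈⟨ interchange _ _ _ _ ⟩
      (A (suc i) j - A (inject₁ i) j) + (c + - c)     ≈⟨ +-congˡ (-‿inverseʳ c) ⟩
      (A (suc i) j - A (inject₁ i) j) + 0#            ≈⟨ +-identityʳ _ ⟩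
      A (suc i) j - A (inject₁ i) j                   ∎

  det-+1+det-−1 : ∀ n (A : Matrix Carrier n) →
                  det n (λ i j → A i j + 1#) + det n (λ i j → A i j - 1#) ≈ det n A + det n A
  det-+1+det-−1 n A = begin
    det n (λ i j → A i j + 1#) + det n (λ i j → A i j - 1#)   ≈⟨ +-cong (affine 1#) (affine (- 1#)) ⟩
    (det n A + 1# * κ) + (det n A + - 1# * κ)                 ≈⟨ interchange _ _ _ _ ⟩
    (det n A + det n A) + (1# * κ + - 1# * κ)                 ≈⟨ +-congˡ (sym (distribʳ κ 1# (- 1#))) ⟩
    (det n A + det n A) + (1# - 1#) * κ                       ≈⟨ +-congˡ (trans (*-congʳ (-‿inverseʳ 1#)) (zeroˡ κ)) ⟩
    (det n A + det n A) + 0#                                  ≈⟨ +-identityʳ _ ⟩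
    det n A + det n A                                         ∎
    where
    κ : Carrier
    κ = proj₁ (det-+-affine n A)
    affine : ∀ c → det n (λ i j → A i j + c) ≈ det n A + c * κ
    affine = proj₂ (det-+-affine n A)

  det-zero-column : ∀ {s} (Y : Matrix Carrier (suc s)) → (∀ r → Y r zero ≈ 0#) → det (suc s) Y ≈ 0#
  det-zero-column {zero}  Y Y≈0 = trans (+-identityʳ _) (laplaceTerm-zeroˡ 1# 1# (Y≈0 zero))
  det-zero-column {suc s} Y Y≈0 = sum-zero {f = λ j → sgn (toℕ j) * (Y zero j * det (suc s) (minor Y j))} λ
    { zero    → laplaceTerm-zeroˡ 1# (det (suc s) (minor Y zero)) (Y≈0 zero)
    ; (suc j) → laplaceTerm-zeroʳ (sgn (toℕ (suc j))) (Y zero (suc j))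
                  (det-zero-column (minor Y (suc j)) λ r → Y≈0 (suc r)) }

  det-zero-corner : ∀ k {s} (Y : Matrix Carrier s) → k ℕ.< s →
                    (∀ r c → k ℕ.≤ toℕ r → toℕ c ℕ.≤ k → Y r c ≈ 0#) → det s Y ≈ 0#
  det-zero-corner zero    {suc s} Y _   Y≈0 = det-zero-column Y λ r → Y≈0 r zero z≤n z≤n
  det-zero-corner (suc k) {suc s} Y k<s Y≈0 = sum-zero λ j →
    laplaceTerm-zeroʳ (sgn (toℕ j)) (Y zero j) (det-zero-corner k (minor Y j) (ℕ.s<s⁻¹ k<s)
      λ r c k≤r c≤k → Y≈0 (suc r) (punchIn j c) (s≤s k≤r) (ℕ.≤-trans (toℕ-punchIn-≤ j c) (s≤s c≤k)))

  det-blockExpansion : ∀ a b (X : Matrix Carrier (suc a ℕ.+ b)) →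
    (∀ i → det (a ℕ.+ b) (minor X (i ↑ˡ b)) ≈
           det a (topLeft a b (minor X (i ↑ˡ b))) * det b (bottomRight a b (minor X (i ↑ˡ b)))) →
    (∀ j → X zero (suc a ↑ʳ j) * det (a ℕ.+ b) (minor X (suc a ↑ʳ j)) ≈ 0#) →
    det (suc a ℕ.+ b) X ≈ det (suc a) (topLeft (suc a) b X) * det b (bottomRight (suc a) b X)
  det-blockExpansion a b X minor≈ right≈0 = begin
    det (suc a ℕ.+ b) X
      ≈⟨ sum-↑ (suc a) term ⟩
    sum (λ i → term (i ↑ˡ b)) + sum (λ j → term (suc a ↑ʳ j))
      ≈⟨ +-cong (sum-cong-≋ left) (sum-zero λ j → trans (*-congˡ (right≈0 j)) (zeroʳ _)) ⟩
    sum (λ i → (sgn (toℕ i) * (P zero i * det a (minor P i))) * det b Q) + 0#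
      ≈⟨ trans (+-identityʳ _) (sym (*-distribʳ-sum (det b Q) λ i → sgn (toℕ i) * (P zero i * det a (minor P i)))) ⟩
    det (suc a) P * det b Q ∎
    where
    P : Matrix Carrier (suc a)
    P = topLeft (suc a) b X
    Q : Matrix Carrier b
    Q = bottomRight (suc a) b X
    term : Fin (suc a ℕ.+ b) → Carrier
    term j = sgn (toℕ j) * (X zero j * det (a ℕ.+ b) (minor X j))
    reassociate : ∀ s x p q → s * (x * (p * q)) ≈ (s * (x * p)) * q
    reassociate = solve 4 (λ s x p q → s :* (x :* (p :* q)) := (s :* (x :* p)) :* q) refl
    left : ∀ i → term (i ↑ˡ b) ≈ (sgn (toℕ i) * (P zero i * det a (minor P i))) * det b Q
    left i = begin
      sgn (toℕ (i ↑ˡ b)) * (X zero (i ↑ˡ b) * det (a ℕ.+ b) (minor X (i ↑ˡ b)))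
        ≈⟨ *-cong (reflexive (≡.cong sgn (Fin.toℕ-↑ˡ i b))) (*-congˡ (trans (minor≈ i) (*-cong
             (det-cong a λ r c → reflexive (≡.cong (X (suc r ↑ˡ b)) (punchIn-↑ˡ b i c)))
             (det-cong b λ r c → reflexive (≡.cong (X (suc a ↑ʳ r)) (punchIn-↑ʳ a i c)))))) ⟩
      sgn (toℕ i) * (X zero (i ↑ˡ b) * (det a (minor P i) * det b Q))
        ≈⟨ reassociate _ _ _ _ ⟩
      (sgn (toℕ i) * (P zero i * det a (minor P i))) * det b Q ∎

  det-blockLower : ∀ a {b} (X : Matrix Carrier (a ℕ.+ b)) →
                   (∀ r c → toℕ r ℕ.< a → a ℕ.≤ toℕ c → X r c ≈ 0#) →
                   det (a ℕ.+ b) X ≈ det a (topLeft a b X) * det b (bottomRight a b X)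
  det-blockLower zero    X X≈0 = sym (*-identityˡ _)
  det-blockLower (suc a) {b} X X≈0 = det-blockExpansion a b X
    (λ i → det-blockLower a (minor X (i ↑ˡ b)) (minorZero i))
    (λ j → trans (*-congʳ (X≈0 zero (suc a ↑ʳ j) (s≤s z≤n) (toℕ-↑ʳ-≥ (suc a) j))) (zeroˡ _))
    where
    minorZero : ∀ i r c → toℕ r ℕ.< a → a ℕ.≤ toℕ c → minor X (i ↑ˡ b) r c ≈ 0#
    minorZero i r c r<a a≤c = X≈0 (suc r) (punchIn (i ↑ˡ b) c) (s≤s r<a)
      (ℕ.≤-trans (s≤s a≤c) (ℕ.≤-reflexive (≡.sym (toℕ-punchIn-≥ (i ↑ˡ b) c
        (ℕ.≤-trans (ℕ.≤-reflexive (Fin.toℕ-↑ˡ i b)) (ℕ.≤-trans (ℕ.s≤s⁻¹ (Fin.toℕ<n i)) a≤c))))))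

  det-blockUpper : ∀ a {b} (X : Matrix Carrier (a ℕ.+ b)) →
                   (∀ r c → a ℕ.≤ toℕ r → toℕ c ℕ.< a → X r c ≈ 0#) →
                   det (a ℕ.+ b) X ≈ det a (topLeft a b X) * det b (bottomRight a b X)
  det-blockUpper zero    X X≈0 = sym (*-identityˡ _)
  det-blockUpper (suc a) {b} X X≈0 = det-blockExpansion a b X
    (λ i → det-blockUpper a (minor X (i ↑ˡ b)) (minorZero i))
    (λ j → trans (*-congˡ (singularMinor j)) (zeroʳ _))
    where
    minorZero : ∀ i r c → a ℕ.≤ toℕ r → toℕ c ℕ.< a → minor X (i ↑ˡ b) r c ≈ 0#
    minorZero i r c a≤r c<a = X≈0 (suc r) (punchIn (i ↑ˡ b) c) (s≤s a≤r)
      (ℕ.≤-<-trans (toℕ-punchIn-≤ (i ↑ˡ b) c) (s≤s c<a))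
    singularMinor : ∀ j → det (a ℕ.+ b) (minor X (suc a ↑ʳ j)) ≈ 0#
    singularMinor j = det-zero-corner a (minor X (suc a ↑ʳ j)) (ℕ.m<m+n a (ℕ.≤-<-trans z≤n (Fin.toℕ<n j)))
      λ r c a≤r c≤a → X≈0 (suc r) (punchIn (suc a ↑ʳ j) c) (s≤s a≤r)
        (ℕ.≤-<-trans (ℕ.≤-reflexive (toℕ-punchIn-< (suc a ↑ʳ j) c
          (ℕ.<-≤-trans (s≤s c≤a) (toℕ-↑ʳ-≥ (suc a) j)))) (s≤s c≤a))

open import Data.Integer as ℤ using (ℤ; +_; -_; 0ℤ; 1ℤ; -1ℤ)
import Data.Integer.Properties as ℤ
open import Data.Integer.Divisibility.Signed using (divides; _∣_; ∣⇒∣ᵤ; ∣ᵤ⇒∣; ∣m∣n⇒∣m+n)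
open import Data.Integer.Tactic.RingSolver using (solve-∀)
open import Data.List using ([]; _∷_)
open import Data.Nat using (_+_; _≤_)
open import Data.Sum using (inj₁; inj₂; [_,_]′)
open import Relation.Binary.Bundles using (Setoid)
import Relation.Binary.Reasoning.Setoid as SetoidReasoning
open import Relation.Nullary using (yes; no)
open ≡ using (refl; sym; trans; cong; cong₂; subst; module ≡-Reasoning)

-- The polynomial ring ℤ[X]

-- Coefficient lists that differ by trailing zeros denote the same polynomial.
infix 4 _≈_
record _≈_ (p q : Poly) : Set where
  constructor coeffwise
  field coeff-≡ : ∀ k → coeff p k ≡ coeff q k
open _≈_ public

≈-refl : ∀ {p} → p ≈ p
≈-refl = coeffwise λ _ → refl

≈-sym : ∀ {p q} → p ≈ q → q ≈ p
≈-sym p≈q = coeffwise λ k → sym (coeff-≡ p≈q k)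

≈-trans : ∀ {p q r} → p ≈ q → q ≈ r → p ≈ r
≈-trans p≈q q≈r = coeffwise λ k → trans (coeff-≡ p≈q k) (coeff-≡ q≈r k)

≈-reflexive : ∀ {p q} → p ≡ q → p ≈ q
≈-reflexive refl = ≈-refl

≈-setoid : Setoid _ _
≈-setoid = record { Carrier = Poly ; _≈_ = _≈_
                  ; isEquivalence = record { refl = ≈-refl ; sym = ≈-sym ; trans = ≈-trans } }

module ≈-Reasoning = SetoidReasoning ≈-setoid

coeff-+ₚ : ∀ p q k → coeff (p +ₚ q) k ≡ coeff p k ℤ.+ coeff q k
coeff-+ₚ []      q       k       = sym (ℤ.+-identityˡ _)
coeff-+ₚ (a ∷ p) []      k       = sym (ℤ.+-identityʳ _)
coeff-+ₚ (a ∷ p) (b ∷ q) zero    = refl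
coeff-+ₚ (a ∷ p) (b ∷ q) (suc k) = coeff-+ₚ p q k

coeff-·ₚ : ∀ c p k → coeff (c ·ₚ p) k ≡ c ℤ.* coeff p k
coeff-·ₚ c []      k       = sym (ℤ.*-zeroʳ c)
coeff-·ₚ c (a ∷ p) zero    = refl
coeff-·ₚ c (a ∷ p) (suc k) = coeff-·ₚ c p k

∷-cong : ∀ {a b p q} → a ≡ b → p ≈ q → a ∷ p ≈ b ∷ q
∷-cong a≡b p≈q = coeffwise λ { zero → a≡b ; (suc k) → coeff-≡ p≈q k }

∷-tail : ∀ {a b p q} → a ∷ p ≈ b ∷ q → p ≈ q
∷-tail e = coeffwise λ k → coeff-≡ e (suc k)

∷-tail-[] : ∀ {a p} → a ∷ p ≈ [] → p ≈ []
∷-tail-[] e = coeffwise λ k → coeff-≡ e (suc k)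

+ₚ-cong : ∀ {p p′ q q′} → p ≈ p′ → q ≈ q′ → p +ₚ q ≈ p′ +ₚ q′
+ₚ-cong {p} {p′} {q} {q′} p≈p′ q≈q′ = coeffwise λ k → begin
  coeff (p +ₚ q) k              ≡⟨ coeff-+ₚ p q k ⟩
  coeff p k ℤ.+ coeff q k       ≡⟨ cong₂ ℤ._+_ (coeff-≡ p≈p′ k) (coeff-≡ q≈q′ k) ⟩
  coeff p′ k ℤ.+ coeff q′ k     ≡⟨ coeff-+ₚ p′ q′ k ⟨
  coeff (p′ +ₚ q′) k            ∎
  where open ≡-Reasoning

+ₚ-congˡ : ∀ p {q q′} → q ≈ q′ → p +ₚ q ≈ p +ₚ q′
+ₚ-congˡ p = +ₚ-cong (≈-refl {p})

·ₚ-congˡ : ∀ c {p q} → p ≈ q → c ·ₚ p ≈ c ·ₚ q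
·ₚ-congˡ c {p} {q} p≈q = coeffwise λ k →
  trans (coeff-·ₚ c p k) (trans (cong (c ℤ.*_) (coeff-≡ p≈q k)) (sym (coeff-·ₚ c q k)))

-ₚ_ : Poly → Poly
-ₚ p = -1ℤ ·ₚ p

1ₚ : Poly
1ₚ = constₚ 1ℤ

0∷[]≈[] : 0ℤ ∷ [] ≈ []
0∷[]≈[] = coeffwise λ { zero → refl ; (suc k) → refl }

+ₚ-assoc : ∀ p q r → (p +ₚ q) +ₚ r ≈ p +ₚ (q +ₚ r)
+ₚ-assoc p q r = coeffwise λ k → begin
  coeff ((p +ₚ q) +ₚ r) k                       ≡⟨ coeff-+ₚ (p +ₚ q) r k ⟩
  coeff (p +ₚ q) k ℤ.+ coeff r k                ≡⟨ cong (ℤ._+ coeff r k) (coeff-+ₚ p q k) ⟩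
  coeff p k ℤ.+ coeff q k ℤ.+ coeff r k         ≡⟨ ℤ.+-assoc (coeff p k) (coeff q k) (coeff r k) ⟩
  coeff p k ℤ.+ (coeff q k ℤ.+ coeff r k)       ≡⟨ cong (ℤ._+_ (coeff p k)) (coeff-+ₚ q r k) ⟨
  coeff p k ℤ.+ coeff (q +ₚ r) k                ≡⟨ coeff-+ₚ p (q +ₚ r) k ⟨
  coeff (p +ₚ (q +ₚ r)) k                       ∎
  where open ≡-Reasoning

+ₚ-comm : ∀ p q → p +ₚ q ≈ q +ₚ p
+ₚ-comm p q = coeffwise λ k →
  trans (coeff-+ₚ p q k) (trans (ℤ.+-comm (coeff p k) (coeff q k)) (sym (coeff-+ₚ q p k)))

+ₚ-identityʳ : ∀ p → p +ₚ [] ≈ p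
+ₚ-identityʳ p = coeffwise λ k → trans (coeff-+ₚ p [] k) (ℤ.+-identityʳ (coeff p k))

-ₚ‿inverseˡ : ∀ p → (-ₚ p) +ₚ p ≈ []
-ₚ‿inverseˡ p = coeffwise λ k → begin
  coeff (-ₚ p +ₚ p) k                ≡⟨ coeff-+ₚ (-ₚ p) p k ⟩
  coeff (-ₚ p) k ℤ.+ coeff p k       ≡⟨ cong (ℤ._+ coeff p k) (coeff-·ₚ -1ℤ p k) ⟩
  -1ℤ ℤ.* coeff p k ℤ.+ coeff p k    ≡⟨ lemma (coeff p k) ⟩
  0ℤ                                 ∎
  where
  open ≡-Reasoning
  lemma : ∀ x → -1ℤ ℤ.* x ℤ.+ x ≡ 0ℤ
  lemma = solve-∀

-ₚ‿inverseʳ : ∀ p → p +ₚ (-ₚ p) ≈ []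
-ₚ‿inverseʳ p = ≈-trans (+ₚ-comm p (-ₚ p)) (-ₚ‿inverseˡ p)

·ₚ-distribˡ : ∀ c p q → c ·ₚ (p +ₚ q) ≈ c ·ₚ p +ₚ c ·ₚ q
·ₚ-distribˡ c p q = coeffwise λ k → begin
  coeff (c ·ₚ (p +ₚ q)) k                       ≡⟨ coeff-·ₚ c (p +ₚ q) k ⟩
  c ℤ.* coeff (p +ₚ q) k                        ≡⟨ cong (c ℤ.*_) (coeff-+ₚ p q k) ⟩
  c ℤ.* (coeff p k ℤ.+ coeff q k)               ≡⟨ ℤ.*-distribˡ-+ c (coeff p k) (coeff q k) ⟩
  c ℤ.* coeff p k ℤ.+ c ℤ.* coeff q k           ≡⟨ cong₂ ℤ._+_ (coeff-·ₚ c p k) (coeff-·ₚ c q k) ⟨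
  coeff (c ·ₚ p) k ℤ.+ coeff (c ·ₚ q) k         ≡⟨ coeff-+ₚ (c ·ₚ p) (c ·ₚ q) k ⟨
  coeff (c ·ₚ p +ₚ c ·ₚ q) k                    ∎
  where open ≡-Reasoning

·ₚ-distribʳ : ∀ a b p → (a ℤ.+ b) ·ₚ p ≈ a ·ₚ p +ₚ b ·ₚ p
·ₚ-distribʳ a b p = coeffwise λ k → begin
  coeff ((a ℤ.+ b) ·ₚ p) k                      ≡⟨ coeff-·ₚ (a ℤ.+ b) p k ⟩
  (a ℤ.+ b) ℤ.* coeff p k                       ≡⟨ ℤ.*-distribʳ-+ (coeff p k) a b ⟩
  a ℤ.* coeff p k ℤ.+ b ℤ.* coeff p k           ≡⟨ cong₂ ℤ._+_ (coeff-·ₚ a p k) (coeff-·ₚ b p k) ⟨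
  coeff (a ·ₚ p) k ℤ.+ coeff (b ·ₚ p) k         ≡⟨ coeff-+ₚ (a ·ₚ p) (b ·ₚ p) k ⟨
  coeff (a ·ₚ p +ₚ b ·ₚ p) k                    ∎
  where open ≡-Reasoning

·ₚ-assoc : ∀ a b p → a ·ₚ (b ·ₚ p) ≈ (a ℤ.* b) ·ₚ p
·ₚ-assoc a b p = coeffwise λ k → begin
  coeff (a ·ₚ (b ·ₚ p)) k        ≡⟨ coeff-·ₚ a (b ·ₚ p) k ⟩
  a ℤ.* coeff (b ·ₚ p) k         ≡⟨ cong (a ℤ.*_) (coeff-·ₚ b p k) ⟩
  a ℤ.* (b ℤ.* coeff p k)        ≡⟨ ℤ.*-assoc a b (coeff p k) ⟨
  a ℤ.* b ℤ.* coeff p k          ≡⟨ coeff-·ₚ (a ℤ.* b) p k ⟨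
  coeff ((a ℤ.* b) ·ₚ p) k       ∎
  where open ≡-Reasoning

0·ₚ : ∀ p → 0ℤ ·ₚ p ≈ []
0·ₚ p = coeffwise λ k → coeff-·ₚ 0ℤ p k

+ₚ-interchange : ∀ p q r s → (p +ₚ q) +ₚ (r +ₚ s) ≈ (p +ₚ r) +ₚ (q +ₚ s)
+ₚ-interchange p q r s = coeffwise λ k → trans (expand p q r s k)
  (trans (lemma (coeff p k) (coeff q k) (coeff r k) (coeff s k)) (sym (expand p r q s k)))
  where
  expand : ∀ p q r s k →
    coeff ((p +ₚ q) +ₚ (r +ₚ s)) k ≡ (coeff p k ℤ.+ coeff q k) ℤ.+ (coeff r k ℤ.+ coeff s k)
  expand p q r s k =
    trans (coeff-+ₚ (p +ₚ q) (r +ₚ s) k) (cong₂ ℤ._+_ (coeff-+ₚ p q k) (coeff-+ₚ r s k))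
  lemma : ∀ a b c d → (a ℤ.+ b) ℤ.+ (c ℤ.+ d) ≡ (a ℤ.+ c) ℤ.+ (b ℤ.+ d)
  lemma = solve-∀

+ₚ-swap : ∀ p q r → p +ₚ (q +ₚ r) ≈ q +ₚ (p +ₚ r)
+ₚ-swap p q r = ≈-trans (≈-sym (+ₚ-assoc p q r))
                 (≈-trans (+ₚ-cong (+ₚ-comm p q) ≈-refl) (+ₚ-assoc q p r))

*ₚ-annihilatedˡ : ∀ {p} q → p ≈ [] → p *ₚ q ≈ []
*ₚ-annihilatedˡ {[]}    q p≈0 = ≈-refl
*ₚ-annihilatedˡ {a ∷ p} q p≈0 = begin
  a ·ₚ q +ₚ (0ℤ ∷ p *ₚ q)   ≈⟨ +ₚ-cong a·q≈0 (∷-cong refl (*ₚ-annihilatedˡ q (∷-tail-[] p≈0))) ⟩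
  [] +ₚ (0ℤ ∷ [])           ≈⟨ 0∷[]≈[] ⟩
  []                        ∎
  where
  open ≈-Reasoning
  a·q≈0 : a ·ₚ q ≈ []
  a·q≈0 = subst (λ c → c ·ₚ q ≈ []) (sym (coeff-≡ p≈0 zero)) (0·ₚ q)

*ₚ-congʳ : ∀ {p p′} q → p ≈ p′ → p *ₚ q ≈ p′ *ₚ q
*ₚ-congʳ {[]}    {[]}     q p≈p′ = ≈-refl
*ₚ-congʳ {[]}    {b ∷ p′} q p≈p′ = ≈-sym (*ₚ-annihilatedˡ q (≈-sym p≈p′))
*ₚ-congʳ {a ∷ p} {[]}     q p≈p′ = *ₚ-annihilatedˡ q p≈p′
*ₚ-congʳ {a ∷ p} {b ∷ p′} q p≈p′ rewrite coeff-≡ p≈p′ zero =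
  +ₚ-cong ≈-refl (∷-cong refl (*ₚ-congʳ q (∷-tail p≈p′)))

*ₚ-congˡ : ∀ p {q q′} → q ≈ q′ → p *ₚ q ≈ p *ₚ q′
*ₚ-congˡ []      q≈q′ = ≈-refl
*ₚ-congˡ (a ∷ p) q≈q′ = +ₚ-cong (·ₚ-congˡ a q≈q′) (∷-cong refl (*ₚ-congˡ p q≈q′))

*ₚ-cong : ∀ {p p′ q q′} → p ≈ p′ → q ≈ q′ → p *ₚ q ≈ p′ *ₚ q′
*ₚ-cong {p′ = p′} {q = q} p≈p′ q≈q′ = ≈-trans (*ₚ-congʳ q p≈p′) (*ₚ-congˡ p′ q≈q′)

*ₚ-distribʳ : ∀ q p p′ → (p +ₚ p′) *ₚ q ≈ p *ₚ q +ₚ p′ *ₚ q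
*ₚ-distribʳ q []      p′       = ≈-refl
*ₚ-distribʳ q (a ∷ p) []       = ≈-sym (+ₚ-identityʳ _)
*ₚ-distribʳ q (a ∷ p) (b ∷ p′) =
  ≈-trans (+ₚ-cong (·ₚ-distribʳ a b q) (∷-cong (sym (ℤ.+-identityˡ 0ℤ)) (*ₚ-distribʳ q p p′)))
          (+ₚ-interchange (a ·ₚ q) (b ·ₚ q) (0ℤ ∷ p *ₚ q) (0ℤ ∷ p′ *ₚ q))

*ₚ-distribˡ : ∀ p q q′ → p *ₚ (q +ₚ q′) ≈ p *ₚ q +ₚ p *ₚ q′
*ₚ-distribˡ []      q q′ = ≈-refl
*ₚ-distribˡ (a ∷ p) q q′ =
  ≈-trans (+ₚ-cong (·ₚ-distribˡ a q q′) (∷-cong (sym (ℤ.+-identityˡ 0ℤ)) (*ₚ-distribˡ p q q′)))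
          (+ₚ-interchange (a ·ₚ q) (a ·ₚ q′) (0ℤ ∷ p *ₚ q) (0ℤ ∷ p *ₚ q′))

·ₚ-*ₚ-assoc : ∀ c q r → (c ·ₚ q) *ₚ r ≈ c ·ₚ (q *ₚ r)
·ₚ-*ₚ-assoc c []      r = ≈-refl
·ₚ-*ₚ-assoc c (a ∷ q) r = begin
  (c ℤ.* a) ·ₚ r +ₚ (0ℤ ∷ (c ·ₚ q) *ₚ r)
    ≈⟨ +ₚ-cong (≈-sym (·ₚ-assoc c a r)) (∷-cong (sym (ℤ.*-zeroʳ c)) (·ₚ-*ₚ-assoc c q r)) ⟩
  c ·ₚ (a ·ₚ r) +ₚ c ·ₚ (0ℤ ∷ q *ₚ r)
    ≈⟨ ·ₚ-distribˡ c (a ·ₚ r) (0ℤ ∷ q *ₚ r) ⟨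
  c ·ₚ (a ·ₚ r +ₚ (0ℤ ∷ q *ₚ r))  ∎
  where open ≈-Reasoning

0∷-*ₚ : ∀ p q → (0ℤ ∷ p) *ₚ q ≈ 0ℤ ∷ p *ₚ q
0∷-*ₚ p q = +ₚ-cong (0·ₚ q) ≈-refl

*ₚ-assoc : ∀ p q r → (p *ₚ q) *ₚ r ≈ p *ₚ (q *ₚ r)
*ₚ-assoc []      q r = ≈-refl
*ₚ-assoc (a ∷ p) q r =
  ≈-trans (*ₚ-distribʳ r (a ·ₚ q) (0ℤ ∷ p *ₚ q))
          (+ₚ-cong (·ₚ-*ₚ-assoc a q r) (≈-trans (0∷-*ₚ (p *ₚ q) r) (∷-cong refl (*ₚ-assoc p q r))))

*ₚ-∷ʳ : ∀ p b q → p *ₚ (b ∷ q) ≈ b ·ₚ p +ₚ (0ℤ ∷ p *ₚ q)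
*ₚ-∷ʳ []      b q = ≈-sym 0∷[]≈[]
*ₚ-∷ʳ (a ∷ p) b q = begin
  (a ℤ.* b ℤ.+ 0ℤ) ∷ (a ·ₚ q +ₚ p *ₚ (b ∷ q))
    ≈⟨ ∷-cong (cong (ℤ._+ 0ℤ) (ℤ.*-comm a b)) (+ₚ-cong ≈-refl (*ₚ-∷ʳ p b q)) ⟩
  (b ℤ.* a ℤ.+ 0ℤ) ∷ (a ·ₚ q +ₚ (b ·ₚ p +ₚ (0ℤ ∷ p *ₚ q)))
    ≈⟨ ∷-cong refl (+ₚ-swap (a ·ₚ q) (b ·ₚ p) _) ⟩
  (b ℤ.* a ℤ.+ 0ℤ) ∷ (b ·ₚ p +ₚ (a ·ₚ q +ₚ (0ℤ ∷ p *ₚ q)))  ∎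
  where open ≈-Reasoning

*ₚ-zeroʳ : ∀ p → p *ₚ [] ≈ []
*ₚ-zeroʳ []      = ≈-refl
*ₚ-zeroʳ (a ∷ p) = ≈-trans (∷-cong refl (*ₚ-zeroʳ p)) 0∷[]≈[]

*ₚ-comm : ∀ p q → p *ₚ q ≈ q *ₚ p
*ₚ-comm []      q = ≈-sym (*ₚ-zeroʳ q)
*ₚ-comm (a ∷ p) q = ≈-sym (≈-trans (*ₚ-∷ʳ q a p) (+ₚ-cong ≈-refl (∷-cong refl (*ₚ-comm q p))))

*ₚ-identityˡ : ∀ p → 1ₚ *ₚ p ≈ p
*ₚ-identityˡ p = coeffwise λ k → begin
  coeff (1ℤ ·ₚ p +ₚ (0ℤ ∷ [])) k        ≡⟨ coeff-≡ (+ₚ-congˡ (1ℤ ·ₚ p) 0∷[]≈[]) k ⟩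
  coeff (1ℤ ·ₚ p +ₚ []) k               ≡⟨ coeff-≡ (+ₚ-identityʳ (1ℤ ·ₚ p)) k ⟩
  coeff (1ℤ ·ₚ p) k                     ≡⟨ coeff-·ₚ 1ℤ p k ⟩
  1ℤ ℤ.* coeff p k                      ≡⟨ ℤ.*-identityˡ (coeff p k) ⟩
  coeff p k                             ∎
  where open ≡-Reasoning

ℤ[X] : CommutativeRing _ _
ℤ[X] = record
  { Carrier = Poly ; _≈_ = _≈_ ; _+_ = _+ₚ_ ; _*_ = _*ₚ_ ; -_ = -ₚ_ ; 0# = [] ; 1# = 1ₚ
  ; isCommutativeRing = record
    { isRing = record
      { +-isAbelianGroup = record
        { isGroup = record
          { isMonoid = record
            { isSemigroup = record
              { isMagma = record { isEquivalence = Setoid.isEquivalence ≈-setoid ; ∙-cong = +ₚ-cong }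
              ; assoc = +ₚ-assoc }
            ; identity = (λ _ → ≈-refl) , +ₚ-identityʳ }
          ; inverse = -ₚ‿inverseˡ , -ₚ‿inverseʳ
          ; ⁻¹-cong = ·ₚ-congˡ -1ℤ }
        ; comm = +ₚ-comm }
      ; *-cong = *ₚ-cong
      ; *-assoc = *ₚ-assoc
      ; *-identity = *ₚ-identityˡ , λ p → ≈-trans (*ₚ-comm p 1ₚ) (*ₚ-identityˡ p)
      ; distrib = *ₚ-distribˡ , *ₚ-distribʳ }
    ; *-comm = *ₚ-comm } }

+ₚ-double-injective : ∀ {p q} → p +ₚ p ≈ q +ₚ q → p ≈ q
+ₚ-double-injective {p} {q} 2p≈2q = coeffwise λ k → ℤ.*-cancelˡ-≡ (+ 2) (coeff p k) (coeff q k) (begin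
  + 2 ℤ.* coeff p k            ≡⟨ double (coeff p k) ⟩
  coeff p k ℤ.+ coeff p k      ≡⟨ coeff-+ₚ p p k ⟨
  coeff (p +ₚ p) k             ≡⟨ coeff-≡ 2p≈2q k ⟩
  coeff (q +ₚ q) k             ≡⟨ coeff-+ₚ q q k ⟩
  coeff q k ℤ.+ coeff q k      ≡⟨ double (coeff q k) ⟨
  + 2 ℤ.* coeff q k            ∎)
  where
  open ≡-Reasoning
  double : ∀ x → + 2 ℤ.* x ≡ x ℤ.+ x
  double = solve-∀

-- Characteristic polynomials

open Determinant ℤ[X]
  using (sgn; det; det-cong; det-+1+det-−1; det-blockLower; det-blockUpper)
open import Algebra.Properties.Semiring.Sum (CommutativeRing.semiring ℤ[X]) using (sum; sum-cong-≋)
open import Algebra.Properties.Semiring.Exp (CommutativeRing.semiring ℤ[X]) using (^-homo-*; ^-congʳ)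
  renaming (_^_ to _^ₚ_)
open import Algebra.Solver.Ring.NaturalCoefficients.Default (CommutativeRing.commutativeSemiring ℤ[X])
  using (solve; _:=_; _:+_; _:*_)

sumFin≡sum : ∀ {n} (f : Fin n → Poly) → sumFin f ≡ sum f
sumFin≡sum {zero}  f = refl
sumFin≡sum {suc n} f = cong (f zero +ₚ_) (sumFin≡sum (λ j → f (suc j)))

-- `charPoly` builds its matrix with a local function, which can only be named through unification.
charPolyMatrix : ∀ n (M : Matrix ℤ n) → Σ (Matrix Poly n) λ F → charPoly n M ≡ detₚ n F
charPolyMatrix n M = _ , refl

xI : ∀ {n} → Fin n → Fin n → Poly
xI i j with i Fin.≟ j
... | yes _ = Xₚ
... | no  _ = []

charMatrix : ∀ {n} → Matrix ℤ n → Matrix Poly n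
charMatrix M i j = xI i j +ₚ constₚ (- M i j)

charPolyMatrix≈charMatrix : ∀ n M i j → proj₁ (charPolyMatrix n M) i j ≈ charMatrix M i j
charPolyMatrix≈charMatrix n M i j with i Fin.≟ j
... | yes _ = ≈-refl
... | no  _ = ≈-refl

constₚ-neg : ∀ c → constₚ (- c) ≈ -ₚ constₚ c
constₚ-neg c = ∷-cong (sym (ℤ.-1*i≡-i c)) ≈-refl

sign-suc : ∀ k → sign (suc k) ≡ - sign k
sign-suc zero          = refl
sign-suc (suc zero)    = refl
sign-suc (suc (suc k)) = sign-suc k

constₚ-sign : ∀ k → constₚ (sign k) ≈ sgn k
constₚ-sign zero    = ≈-refl
constₚ-sign (suc k) = ≈-trans (≈-reflexive (cong constₚ (sign-suc k)))
                              (≈-trans (constₚ-neg (sign k)) (·ₚ-congˡ -1ℤ (constₚ-sign k)))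

·ₚ≈constₚ*ₚ : ∀ c p → c ·ₚ p ≈ constₚ c *ₚ p
·ₚ≈constₚ*ₚ c p = ≈-sym (≈-trans (+ₚ-cong ≈-refl 0∷[]≈[]) (+ₚ-identityʳ (c ·ₚ p)))

detₚ≈det : ∀ n (F : Matrix Poly n) → detₚ n F ≈ det n F
detₚ≈det zero    F = ≈-refl
detₚ≈det (suc n) F = ≈-trans (≈-reflexive (sumFin≡sum expansion)) (sum-cong-≋ λ j →
  ≈-trans (·ₚ≈constₚ*ₚ (sign (toℕ j)) _)
          (*ₚ-cong (constₚ-sign (toℕ j)) (*ₚ-congˡ (F zero j) (detₚ≈det n (minor F j)))))
  where
  expansion : Fin (suc n) → Poly
  expansion j = sign (toℕ j) ·ₚ (F zero j *ₚ detₚ n (minor F j))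

charPoly≈det : ∀ n (M : Matrix ℤ n) → charPoly n M ≈ det n (charMatrix M)
charPoly≈det n M = ≈-trans (detₚ≈det n (proj₁ (charPolyMatrix n M)))
                           (det-cong n (charPolyMatrix≈charMatrix n M))

charPoly-cong : ∀ n {M N : Matrix ℤ n} → (∀ i j → M i j ≡ N i j) → charPoly n M ≈ charPoly n N
charPoly-cong n {M} {N} M≡N = ≈-trans (charPoly≈det n M) (≈-trans
  (det-cong n λ i j → ≈-reflexive (cong (λ x → xI i j +ₚ constₚ (- x)) (M≡N i j)))
  (≈-sym (charPoly≈det n N)))

shift : ∀ {n} → ℤ → Matrix ℤ n → Matrix ℤ n
shift c M i j = M i j ℤ.+ c

charMatrix-shift : ∀ {n} c (M : Matrix ℤ n) i j → charMatrix (shift c M) i j ≈ charMatrix M i j +ₚ constₚ (- c)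
charMatrix-shift c M i j = ≈-trans
  (+ₚ-congˡ (xI i j) (≈-reflexive (cong constₚ (ℤ.neg-distrib-+ (M i j) c))))
  (≈-sym (+ₚ-assoc (xI i j) (constₚ (- M i j)) (constₚ (- c))))

charPoly-shift⁻+shift⁺ : ∀ n (M : Matrix ℤ n) →
  charPoly n (shift -1ℤ M) +ₚ charPoly n (shift 1ℤ M) ≈ charPoly n M +ₚ charPoly n M
charPoly-shift⁻+shift⁺ n M = begin
  charPoly n (shift -1ℤ M) +ₚ charPoly n (shift 1ℤ M)
    ≈⟨ +ₚ-cong (≈-trans (charPoly≈det n _) (det-cong n (charMatrix-shift -1ℤ M)))
               (≈-trans (charPoly≈det n _) (det-cong n (charMatrix-shift 1ℤ M))) ⟩
  det n (λ i j → charMatrix M i j +ₚ 1ₚ) +ₚ det n (λ i j → charMatrix M i j +ₚ -ₚ 1ₚ)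
    ≈⟨ det-+1+det-−1 n (charMatrix M) ⟩
  det n (charMatrix M) +ₚ det n (charMatrix M)
    ≈⟨ +ₚ-cong (charPoly≈det n M) (charPoly≈det n M) ⟨
  charPoly n M +ₚ charPoly n M ∎
  where open ≈-Reasoning

xI-injective : ∀ {m n} (f : Fin m → Fin n) → (∀ {i j} → f i ≡ f j → i ≡ j) → ∀ i j → xI (f i) (f j) ≡ xI i j
xI-injective f f-inj i j with f i Fin.≟ f j | i Fin.≟ j
... | yes _     | yes _    = refl
... | no  _     | no  _    = refl
... | yes fi≡fj | no  i≢j  = ⊥-elim (i≢j (f-inj fi≡fj))
... | no  fi≢fj | yes refl = ⊥-elim (fi≢fj refl)

charMatrix-off : ∀ {n} (M : Matrix ℤ n) r c → r ≢ c → M r c ≡ 0ℤ → charMatrix M r c ≈ []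
charMatrix-off M r c r≢c Mrc≡0 with r Fin.≟ c
... | yes r≡c = ⊥-elim (r≢c r≡c)
... | no  _   rewrite Mrc≡0 = 0∷[]≈[]

charPoly-blocks : ∀ a b (X : Matrix ℤ (a + b)) →
  det (a + b) (charMatrix X) ≈
    det a (topLeft a b (charMatrix X)) *ₚ det b (bottomRight a b (charMatrix X)) →
  charPoly (a + b) X ≈ charPoly a (topLeft a b X) *ₚ charPoly b (bottomRight a b X)
charPoly-blocks a b X blocks = begin
  charPoly (a + b) X
    ≈⟨ charPoly≈det (a + b) X ⟩
  det (a + b) (charMatrix X)
    ≈⟨ blocks ⟩
  det a (topLeft a b (charMatrix X)) *ₚ det b (bottomRight a b (charMatrix X))
    ≈⟨ *ₚ-cong (det-cong a λ i j → ≈-reflexive (cong (_+ₚ constₚ (- topLeft a b X i j))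
                                             (xI-injective (_↑ˡ b) (Fin.↑ˡ-injective b _ _) i j)))
               (det-cong b λ i j → ≈-reflexive (cong (_+ₚ constₚ (- bottomRight a b X i j))
                                             (xI-injective (a ↑ʳ_) (Fin.↑ʳ-injective a _ _) i j))) ⟩
  det a (charMatrix (topLeft a b X)) *ₚ det b (charMatrix (bottomRight a b X))
    ≈⟨ *ₚ-cong (charPoly≈det a _) (charPoly≈det b _) ⟨
  charPoly a (topLeft a b X) *ₚ charPoly b (bottomRight a b X) ∎
  where open ≈-Reasoning

-- Tournaments

-- Every vertex of the first tournament beats every vertex of the second.
_⊳_ : ∀ {a b} → Matrix ℤ a → Matrix ℤ b → Matrix ℤ (a + b)
_⊳_ {a} M N r c = [ (λ i → [ M i , (λ _ → 1ℤ) ]′ (splitAt a c)) ,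
                    (λ i → [ (λ _ → -1ℤ) , N i ]′ (splitAt a c)) ]′ (splitAt a r)

module _ {a b} (M : Matrix ℤ a) (N : Matrix ℤ b) where

  ⊳-topLeft : ∀ i j → topLeft a b (M ⊳ N) i j ≡ M i j
  ⊳-topLeft i j rewrite Fin.splitAt-↑ˡ a i b | Fin.splitAt-↑ˡ a j b = refl

  ⊳-bottomRight : ∀ i j → bottomRight a b (M ⊳ N) i j ≡ N i j
  ⊳-bottomRight i j rewrite Fin.splitAt-↑ʳ a b i | Fin.splitAt-↑ʳ a b j = refl

  ⊳-topRight : ∀ r c → toℕ r ℕ.< a → a ℕ.≤ toℕ c → (M ⊳ N) r c ≡ 1ℤ
  ⊳-topRight r c r<a a≤c rewrite Fin.splitAt-< a r r<a | Fin.splitAt-≥ a c a≤c = refl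

  ⊳-bottomLeft : ∀ r c → a ℕ.≤ toℕ r → toℕ c ℕ.< a → (M ⊳ N) r c ≡ -1ℤ
  ⊳-bottomLeft r c a≤r c<a rewrite Fin.splitAt-≥ a r a≤r | Fin.splitAt-< a c c<a = refl

  -- Shifting by -J clears the top right block, shifting by J the bottom left one.
  charPoly-shift⁻-⊳ : charPoly (a + b) (shift -1ℤ (M ⊳ N)) ≈
                      charPoly a (shift -1ℤ M) *ₚ charPoly b (shift -1ℤ N)
  charPoly-shift⁻-⊳ = ≈-trans
    (charPoly-blocks a b (shift -1ℤ (M ⊳ N)) (det-blockLower a (charMatrix (shift -1ℤ (M ⊳ N))) λ r c r<a a≤c →
      charMatrix-off (shift -1ℤ (M ⊳ N)) r c (λ r≡c → ℕ.<⇒≢ (ℕ.<-≤-trans r<a a≤c) (cong toℕ r≡c))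
                           (cong (ℤ._+ -1ℤ) (⊳-topRight r c r<a a≤c))))
    (*ₚ-cong (charPoly-cong a λ i j → cong (ℤ._+ -1ℤ) (⊳-topLeft i j))
             (charPoly-cong b λ i j → cong (ℤ._+ -1ℤ) (⊳-bottomRight i j)))

  charPoly-shift⁺-⊳ : charPoly (a + b) (shift 1ℤ (M ⊳ N)) ≈
                      charPoly a (shift 1ℤ M) *ₚ charPoly b (shift 1ℤ N)
  charPoly-shift⁺-⊳ = ≈-trans
    (charPoly-blocks a b (shift 1ℤ (M ⊳ N)) (det-blockUpper a (charMatrix (shift 1ℤ (M ⊳ N))) λ r c a≤r c<a →
      charMatrix-off (shift 1ℤ (M ⊳ N)) r c (λ r≡c → ℕ.<⇒≢ (ℕ.<-≤-trans c<a a≤r) (cong toℕ (sym r≡c)))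
                           (cong (ℤ._+ 1ℤ) (⊳-bottomLeft r c a≤r c<a))))
    (*ₚ-cong (charPoly-cong a λ i j → cong (ℤ._+ 1ℤ) (⊳-topLeft i j))
             (charPoly-cong b λ i j → cong (ℤ._+ 1ℤ) (⊳-bottomRight i j)))

⊳-InT : ∀ {a b} {M : Matrix ℤ a} {N : Matrix ℤ b} → InT a M → InT b N → InT (a + b) (M ⊳ N)
⊳-InT {a} {b} {M} {N} M∈T N∈T = record { entries = signs ; diag1 = diagonal ; skew = skewSymmetric }
  where
  signs : ∀ r c → IsSign ((M ⊳ N) r c)
  signs r c with splitAt a r | splitAt a c
  ... | inj₁ i | inj₁ j = InT.entries M∈T i j
  ... | inj₁ _ | inj₂ _ = plus
  ... | inj₂ _ | inj₁ _ = minus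
  ... | inj₂ i | inj₂ j = InT.entries N∈T i j
  diagonal : ∀ r → (M ⊳ N) r r ≡ 1ℤ
  diagonal r with splitAt a r
  ... | inj₁ i = InT.diag1 M∈T i
  ... | inj₂ i = InT.diag1 N∈T i
  skewSymmetric : ∀ r c → r ≢ c → (M ⊳ N) c r ≡ - (M ⊳ N) r c
  skewSymmetric r c r≢c with splitAt a r in r≡ | splitAt a c in c≡
  ... | inj₁ i | inj₁ j = InT.skew M∈T i j λ i≡j →
          r≢c (trans (sym (Fin.splitAt⁻¹-↑ˡ r≡)) (trans (cong (_↑ˡ b) i≡j) (Fin.splitAt⁻¹-↑ˡ c≡)))
  ... | inj₁ _ | inj₂ _ = refl
  ... | inj₂ _ | inj₁ _ = refl
  ... | inj₂ i | inj₂ j = InT.skew N∈T i j λ i≡j →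
          r≢c (trans (sym (Fin.splitAt⁻¹-↑ʳ r≡)) (trans (cong (a ↑ʳ_) i≡j) (Fin.splitAt⁻¹-↑ʳ c≡)))

-- Vertex i beats vertex j exactly when i < j.
transitive : ∀ n → Matrix ℤ n
transitive zero    = λ ()
transitive (suc n) = (λ _ _ → 1ℤ) ⊳ transitive n

transitive-InT : ∀ n → InT n (transitive n)
transitive-InT zero    = record { entries = λ () ; diag1 = λ () ; skew = λ () }
transitive-InT (suc n) = ⊳-InT singleton (transitive-InT n)
  where
  singleton : InT 1 (λ _ _ → 1ℤ)
  singleton = record { entries = λ _ _ → plus ; diag1 = λ _ → refl
                     ; skew = λ { zero zero 0≢0 → ⊥-elim (0≢0 refl) } }

Xₚ-2 : Poly
Xₚ-2 = Xₚ +ₚ constₚ (- + 2)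

charPoly-[1]-shift⁻ : charPoly 1 (shift -1ℤ (λ _ _ → 1ℤ)) ≈ Xₚ
charPoly-[1]-shift⁻ = coeffwise λ { zero → refl ; (suc zero) → refl ; (suc (suc k)) → refl }

charPoly-[1]-shift⁺ : charPoly 1 (shift 1ℤ (λ _ _ → 1ℤ)) ≈ Xₚ-2
charPoly-[1]-shift⁺ = coeffwise λ { zero → refl ; (suc zero) → refl ; (suc (suc k)) → refl }

charPoly-transitive-shift⁻ : ∀ n → charPoly n (shift -1ℤ (transitive n)) ≈ Xₚ ^ₚ n
charPoly-transitive-shift⁻ zero    = ≈-refl
charPoly-transitive-shift⁻ (suc n) = ≈-trans (charPoly-shift⁻-⊳ {1} (λ _ _ → 1ℤ) (transitive n))
                                              (*ₚ-cong charPoly-[1]-shift⁻ (charPoly-transitive-shift⁻ n))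

charPoly-transitive-shift⁺ : ∀ n → charPoly n (shift 1ℤ (transitive n)) ≈ Xₚ-2 ^ₚ n
charPoly-transitive-shift⁺ zero    = ≈-refl
charPoly-transitive-shift⁺ (suc n) = ≈-trans (charPoly-shift⁺-⊳ {1} (λ _ _ → 1ℤ) (transitive n))
                                              (*ₚ-cong charPoly-[1]-shift⁺ (charPoly-transitive-shift⁺ n))

constₚ-2^suc : ∀ k → constₚ (+ 2 ^ suc k) ≈ constₚ (+ 2 ^ k) +ₚ constₚ (+ 2 ^ k)
constₚ-2^suc k = ∷-cong (trans (cong (λ x → + (2 ^ k + x)) (ℕ.+-identityʳ (2 ^ k))) (ℤ.pos-+ (2 ^ k) (2 ^ k))) ≈-refl

-- Squaring x^m + 2^(k+1) q gives x^(2m) + 2^(k+2) (x^m q + 2^k q²).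
Xₚ-2^2^k : ∀ k → ∃ λ q → Xₚ-2 ^ₚ (2 ^ k) ≈ Xₚ ^ₚ (2 ^ k) +ₚ constₚ (+ 2 ^ suc k) *ₚ q
Xₚ-2^2^k zero    = constₚ -1ℤ , coeffwise λ { zero → refl ; (suc zero) → refl ; (suc (suc k)) → refl }
Xₚ-2^2^k (suc k) = Xₚ ^ₚ m *ₚ q +ₚ u *ₚ (q *ₚ q) , (begin
  Xₚ-2 ^ₚ (m + (m + 0))                           ≈⟨ square Xₚ-2 ⟩
  Xₚ-2 ^ₚ m *ₚ Xₚ-2 ^ₚ m                          ≈⟨ *ₚ-cong step step ⟩
  (Xₚ ^ₚ m +ₚ (u +ₚ u) *ₚ q) *ₚ (Xₚ ^ₚ m +ₚ (u +ₚ u) *ₚ q)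
                                                  ≈⟨ expand (Xₚ ^ₚ m) u q ⟩
  Xₚ ^ₚ m *ₚ Xₚ ^ₚ m +ₚ ((u +ₚ u) +ₚ (u +ₚ u)) *ₚ (Xₚ ^ₚ m *ₚ q +ₚ u *ₚ (q *ₚ q))
                                                  ≈⟨ +ₚ-cong (≈-sym (square Xₚ)) (*ₚ-congʳ (Xₚ ^ₚ m *ₚ q +ₚ u *ₚ (q *ₚ q)) four) ⟩
  Xₚ ^ₚ (m + (m + 0)) +ₚ constₚ (+ 2 ^ suc (suc k)) *ₚ (Xₚ ^ₚ m *ₚ q +ₚ u *ₚ (q *ₚ q)) ∎)
  where
  open ≈-Reasoning
  m : ℕ
  m = 2 ^ k
  u q : Poly
  u = constₚ (+ m)
  q = proj₁ (Xₚ-2^2^k k)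
  square : ∀ x → x ^ₚ (m + (m + 0)) ≈ x ^ₚ m *ₚ x ^ₚ m
  square x = ≈-trans (^-homo-* x m (m + 0)) (*ₚ-congˡ (x ^ₚ m) (^-congʳ x (ℕ.+-identityʳ m)))
  step : Xₚ-2 ^ₚ m ≈ Xₚ ^ₚ m +ₚ (u +ₚ u) *ₚ q
  step = ≈-trans (proj₂ (Xₚ-2^2^k k)) (+ₚ-congˡ (Xₚ ^ₚ m) (*ₚ-congʳ q (constₚ-2^suc k)))
  four : (u +ₚ u) +ₚ (u +ₚ u) ≈ constₚ (+ 2 ^ suc (suc k))
  four = ≈-sym (≈-trans (constₚ-2^suc (suc k)) (+ₚ-cong (constₚ-2^suc k) (constₚ-2^suc k)))
  expand : ∀ a u q → (a +ₚ (u +ₚ u) *ₚ q) *ₚ (a +ₚ (u +ₚ u) *ₚ q) ≈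
                     a *ₚ a +ₚ ((u +ₚ u) +ₚ (u +ₚ u)) *ₚ (a *ₚ q +ₚ u *ₚ (q *ₚ q))
  expand = solve 3 (λ a u q → (a :+ (u :+ u) :* q) :* (a :+ (u :+ u) :* q) :=
                              a :* a :+ ((u :+ u) :+ (u :+ u)) :* (a :* q :+ u :* (q :* q))) ≈-refl

-- Coefficients modulo 2^e

Xₚ*ₚ : ∀ p → Xₚ *ₚ p ≈ 0ℤ ∷ p
Xₚ*ₚ p = ≈-trans (+ₚ-cong (0·ₚ p) ≈-refl) (∷-cong refl (*ₚ-identityˡ p))

Xₚ^suc*ₚ : ∀ m p → Xₚ ^ₚ suc m *ₚ p ≈ 0ℤ ∷ Xₚ ^ₚ m *ₚ p
Xₚ^suc*ₚ m p = ≈-trans (*ₚ-assoc Xₚ (Xₚ ^ₚ m) p) (Xₚ*ₚ (Xₚ ^ₚ m *ₚ p))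

coeff-Xₚ^*ₚ-+ : ∀ m p j → coeff (Xₚ ^ₚ m *ₚ p) (m + j) ≡ coeff p j
coeff-Xₚ^*ₚ-+ zero    p j = coeff-≡ (*ₚ-identityˡ p) j
coeff-Xₚ^*ₚ-+ (suc m) p j = trans (coeff-≡ (Xₚ^suc*ₚ m p) (suc (m + j))) (coeff-Xₚ^*ₚ-+ m p j)

coeff-Xₚ^*ₚ-< : ∀ m p k → k ℕ.< m → coeff (Xₚ ^ₚ m *ₚ p) k ≡ 0ℤ
coeff-Xₚ^*ₚ-< (suc m) p zero    _   = coeff-≡ (Xₚ^suc*ₚ m p) zero
coeff-Xₚ^*ₚ-< (suc m) p (suc k) k<m = trans (coeff-≡ (Xₚ^suc*ₚ m p) (suc k)) (coeff-Xₚ^*ₚ-< m p k (ℕ.s<s⁻¹ k<m))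

coeff-constₚ*ₚ : ∀ c p k → coeff (constₚ c *ₚ p) k ≡ c ℤ.* coeff p k
coeff-constₚ*ₚ c p k = trans (sym (coeff-≡ (·ₚ≈constₚ*ₚ c p) k)) (coeff-·ₚ c p k)

≡[mod2^]-intro : ∀ e {x y} r → x ≡ y ℤ.+ + 2 ^ e ℤ.* r → x ≡[mod2^ e ] y
≡[mod2^]-intro e {x} {y} r x≡y+2^er = ∣⇒∣ᵤ (divides r (begin
  x ℤ.- y                      ≡⟨ cong (ℤ._- y) x≡y+2^er ⟩
  y ℤ.+ + 2 ^ e ℤ.* r ℤ.- y    ≡⟨ cancel y (+ 2 ^ e) r ⟩
  r ℤ.* + 2 ^ e                ∎))
  where
  open ≡-Reasoning
  cancel : ∀ y d r → y ℤ.+ d ℤ.* r ℤ.- y ≡ r ℤ.* d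
  cancel = solve-∀

≡[mod2^]-refl : ∀ e {x} → x ≡[mod2^ e ] x
≡[mod2^]-refl e {x} = ≡[mod2^]-intro e 0ℤ (sym (trans (cong (ℤ._+_ x) (ℤ.*-zeroʳ (+ 2 ^ e))) (ℤ.+-identityʳ x)))

≡[mod2^]-trans : ∀ e {x y z} → x ≡[mod2^ e ] y → y ≡[mod2^ e ] z → x ≡[mod2^ e ] z
≡[mod2^]-trans e {x} {y} {z} x≡y y≡z =
  ∣⇒∣ᵤ (subst (+ 2 ^ e ∣_) (telescope x y z)
         (∣m∣n⇒∣m+n (∣ᵤ⇒∣ {+ 2 ^ e} {x ℤ.- y} x≡y) (∣ᵤ⇒∣ {+ 2 ^ e} {y ℤ.- z} y≡z)))
  where
  telescope : ∀ x y z → (x ℤ.- y) ℤ.+ (y ℤ.- z) ≡ x ℤ.- z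
  telescope = solve-∀

module _ (n e : ℕ) (M : Matrix ℤ n) where

  private
    m : ℕ
    m = 2 ^ e
    p p′ t u : Poly
    p  = charPoly n M
    p′ = charPoly (n + m) (M ⊳ transitive m)
    t  = charPoly n (shift -1ℤ M)
    u  = charPoly n (shift 1ℤ M)

  charPoly-⊳-transitive : ∃ λ r → p′ ≈ Xₚ ^ₚ m *ₚ p +ₚ constₚ (+ m) *ₚ r
  charPoly-⊳-transitive = u *ₚ q , +ₚ-double-injective (begin
    p′ +ₚ p′
      ≈⟨ charPoly-shift⁻+shift⁺ (n + m) (M ⊳ transitive m) ⟨
    charPoly (n + m) (shift -1ℤ (M ⊳ transitive m)) +ₚ charPoly (n + m) (shift 1ℤ (M ⊳ transitive m))
      ≈⟨ +ₚ-cong (≈-trans (charPoly-shift⁻-⊳ M (transitive m)) (*ₚ-congˡ t (charPoly-transitive-shift⁻ m)))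
                 (≈-trans (charPoly-shift⁺-⊳ M (transitive m)) (*ₚ-congˡ u (charPoly-transitive-shift⁺ m))) ⟩
    t *ₚ Xₚ ^ₚ m +ₚ u *ₚ Xₚ-2 ^ₚ m
      ≈⟨ +ₚ-congˡ (t *ₚ Xₚ ^ₚ m) (*ₚ-congˡ u (≈-trans (proj₂ (Xₚ-2^2^k e))
           (+ₚ-congˡ (Xₚ ^ₚ m) (*ₚ-congʳ q (constₚ-2^suc e))))) ⟩
    t *ₚ Xₚ ^ₚ m +ₚ u *ₚ (Xₚ ^ₚ m +ₚ (c +ₚ c) *ₚ q)
      ≈⟨ collect t u (Xₚ ^ₚ m) c q ⟩
    Xₚ ^ₚ m *ₚ (t +ₚ u) +ₚ (c +ₚ c) *ₚ (u *ₚ q)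
      ≈⟨ +ₚ-cong (*ₚ-congˡ (Xₚ ^ₚ m) (charPoly-shift⁻+shift⁺ n M)) ≈-refl ⟩
    Xₚ ^ₚ m *ₚ (p +ₚ p) +ₚ (c +ₚ c) *ₚ (u *ₚ q)
      ≈⟨ halve (Xₚ ^ₚ m) p c (u *ₚ q) ⟩
    (Xₚ ^ₚ m *ₚ p +ₚ c *ₚ (u *ₚ q)) +ₚ (Xₚ ^ₚ m *ₚ p +ₚ c *ₚ (u *ₚ q)) ∎)
    where
    open ≈-Reasoning
    c q : Poly
    c = constₚ (+ m)
    q = proj₁ (Xₚ-2^2^k e)
    collect : ∀ t u a c q → t *ₚ a +ₚ u *ₚ (a +ₚ (c +ₚ c) *ₚ q) ≈ a *ₚ (t +ₚ u) +ₚ (c +ₚ c) *ₚ (u *ₚ q)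
    collect = solve 5 (λ t u a c q →
      t :* a :+ u :* (a :+ (c :+ c) :* q) := a :* (t :+ u) :+ (c :+ c) :* (u :* q)) ≈-refl
    halve : ∀ a p c r → a *ₚ (p +ₚ p) +ₚ (c +ₚ c) *ₚ r ≈ (a *ₚ p +ₚ c *ₚ r) +ₚ (a *ₚ p +ₚ c *ₚ r)
    halve = solve 4 (λ a p c r →
      a :* (p :+ p) :+ (c :+ c) :* r := (a :* p :+ c :* r) :+ (a :* p :+ c :* r)) ≈-refl

  coeff-⊳-transitive : ∀ k → coeff p′ k ≡[mod2^ e ] coeff (Xₚ ^ₚ m *ₚ p) k
  coeff-⊳-transitive k = ≡[mod2^]-intro e (coeff r k) (begin
    coeff p′ k                                                ≡⟨ coeff-≡ p′≈ k ⟩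
    coeff (Xₚ ^ₚ m *ₚ p +ₚ constₚ (+ m) *ₚ r) k               ≡⟨ coeff-+ₚ (Xₚ ^ₚ m *ₚ p) (constₚ (+ m) *ₚ r) k ⟩
    coeff (Xₚ ^ₚ m *ₚ p) k ℤ.+ coeff (constₚ (+ m) *ₚ r) k    ≡⟨ cong (ℤ._+_ (coeff (Xₚ ^ₚ m *ₚ p) k)) (coeff-constₚ*ₚ (+ m) r k) ⟩
    coeff (Xₚ ^ₚ m *ₚ p) k ℤ.+ + m ℤ.* coeff r k              ∎)
    where
    open ≡-Reasoning
    r : Poly
    r = proj₁ charPoly-⊳-transitive
    p′≈ : p′ ≈ Xₚ ^ₚ m *ₚ p +ₚ constₚ (+ m) *ₚ r
    p′≈ = proj₂ charPoly-⊳-transitive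

  charCoeff-⊳-transitive : ∀ i → charCoeff (n + m) (M ⊳ transitive m) i ≡[mod2^ e ] charCoeff n M i
  charCoeff-⊳-transitive i with i ℕ.≤? n + m | i ℕ.≤? n
  ... | yes _      | yes i≤n rewrite ℕ.+-∸-comm m i≤n | ℕ.+-comm (n ℕ.∸ i) m =
    subst (coeff p′ (m + (n ℕ.∸ i)) ≡[mod2^ e ]_) (coeff-Xₚ^*ₚ-+ m p (n ℕ.∸ i))
          (coeff-⊳-transitive (m + (n ℕ.∸ i)))
  ... | yes i≤n+m | no i≰n =
    subst (coeff p′ (n + m ℕ.∸ i) ≡[mod2^ e ]_) (coeff-Xₚ^*ₚ-< m p (n + m ℕ.∸ i) below)
          (coeff-⊳-transitive (n + m ℕ.∸ i))
    where
    below : n + m ℕ.∸ i ℕ.< m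
    below = ℕ.<-≤-trans (ℕ.∸-monoʳ-< (ℕ.≰⇒> i≰n) i≤n+m) (ℕ.≤-reflexive (ℕ.m+n∸m≡n n m))
  ... | no i≰n+m  | yes i≤n = ⊥-elim (i≰n+m (ℕ.≤-trans i≤n (ℕ.m≤m+n n m)))
  ... | no _      | no _    = ≡[mod2^]-refl e {0ℤ}

proposition7p2 : (n e : ℕ) → 1 ≤ n → 1 ≤ e →
    (a : ℕ → ℤ) → InC e n a → InC e (n + 2 ^ e) a
proposition7p2 n e _ _ a (M , M∈T , M≡a) = M′ , ⊳-InT M∈T (transitive-InT (2 ^ e)) , λ i 2≤i i≤e →
  ≡[mod2^]-trans e {charCoeff (n + 2 ^ e) M′ i} {charCoeff n M i} {a i}
    (charCoeff-⊳-transitive n e M i) (M≡a i 2≤i i≤e)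
  where
  M′ : Matrix ℤ (n + 2 ^ e)
  M′ = M ⊳ transitive (2 ^ e)
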